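{- There exists a language \(L\) and an \(L\) n-clause set \(S(\eta)\) refuted by a cycle such that open induction over \(L\) does not prove \(\neg S(\eta)\).
   Context: Many-sorted classical first-order logic with a sort \(\mathrm{nat}\), \(\mathsf{0} : \mathrm{nat}\), \(\mathsf{s} : \mathrm{nat} \to \mathrm{nat}\); languages for n-clauses have at least one further sort and no other function symbols of range \(\mathrm{nat}\). \(\eta\) is a distinguished free variable of sort \(\mathrm{nat}\), \(\overline{k} := \mathsf{s}^{k}\mathsf{0}\). An n-clause is a clause \(\forall \vec{x}\,(N(\eta,\vec{x}) \vee C(\vec{x}))\) with \(N\) a disjunction of literals \(\eta \neq t(\vec{x})\) and \(C\) a disjunction of (in)equations between terms of sort other than \(\mathrm{nat}\); an n-clause set is a conjunction of n-clauses. For \(\mathcal{C} = \forall \vec{x}\,(\bigvee_{l=1}^{k}\eta \neq t_{l} \vee C)\), \(\mathcal{C}{\downarrow_{i}} := \forall \vec{x}\,(\bigvee_{l=1}^{k}\eta \neq \mathsf{s}^{i}(t_{l}) \vee C)\), extended conjunctively. A triple \((i,j,S)\) with \(j>0\) and \(S \subseteq R\) is a cycle for an n-clause set \(R\) if \(S \vdash \eta \neq \overline{k}\) for \(k = i,\dots,i+j-1\) and \(S \vdash S{\downarrow_{j}}\); \(R\) is refuted by a cycle if there is a cycle \((i,j,S)\) for \(R\) with \(R \vdash \eta \neq \overline{k}\) for \(k=0,\dots,i-1\). Open induction over \(L\) is the theory consisting of all axioms \(\forall \vec{z}\,(\psi(\mathsf{0},\vec{z}) \rightarrow \forall x\,(\psi(x,\vec{z})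 \rightarrow \psi(\mathsf{s}x,\vec{z})) \rightarrow \forall x\,\psi(x,\vec{z}))\) for quantifier-free \(L\) formulas \(\psi(x,\vec{z})\) with \(x\) of sort \(\mathrm{nat}\). -}

module Defs where

open import Data.List using (List; []; _∷_; _++_; map)
open import Data.List.Relation.Binary.Subset.Propositional using (_⊆_)
open import Data.Nat using (ℕ; zero; suc; _<_; _≤_; _+_)
open import Data.Bool using (Bool; true; false)
open import Data.Product using (Σ; _×_; _,_)
open import Data.Empty using (⊥)
open import Relation.Binary.PropositionalEquality using (_≡_; _≢_)

-- Many-sorted first-order languages with equality, with a distinguished
-- sort nat; the symbols 0 and s are built into the term syntax, so
-- 'Fun' collects the *other* function symbols.

record Language : Set₁ where
  field
    Sort : Set
    nat  : Sort
    Fun  : Set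
    dom  : Fun → List Sort
    cod  : Fun → Sort

NLanguage : Language → Set
NLanguage L = Σ Sort (λ σ → σ ≢ nat) × (∀ (f : Fun) → cod f ≢ nat)
  where open Language L

module Syntax (L : Language) where
  open Language L

  Ctx : Set
  Ctx = List Sort

  data _∋_ : Ctx → Sort → Set where
    here  : ∀ {Γ σ} → (σ ∷ Γ) ∋ σ
    there : ∀ {Γ σ τ} → Γ ∋ σ → (τ ∷ Γ) ∋ σ

  mutual
    data Term (Γ : Ctx) : Sort → Set where
      var  : ∀ {σ} → Γ ∋ σ → Term Γ σ
      zeroᵗ : Term Γ nat
      sucᵗ  : Term Γ nat → Term Γ nat
      app  : (f : Fun) → Terms Γ (dom f) → Term Γ (cod f)

    data Terms (Γ : Ctx) : List Sort → Set where
      []  : Terms Γ []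
      _∷_ : ∀ {σ σs} → Term Γ σ → Terms Γ σs → Terms Γ (σ ∷ σs)

  Ren : Ctx → Ctx → Set
  Ren Γ Δ = ∀ {σ} → Γ ∋ σ → Δ ∋ σ

  liftR : ∀ {Γ Δ τ} → Ren Γ Δ → Ren (τ ∷ Γ) (τ ∷ Δ)
  liftR r here      = here
  liftR r (there x) = there (r x)

  mutual
    renT : ∀ {Γ Δ σ} → Ren Γ Δ → Term Γ σ → Term Δ σ
    renT r (var x)   = var (r x)
    renT r zeroᵗ     = zeroᵗ
    renT r (sucᵗ t)  = sucᵗ (renT r t)
    renT r (app f ts) = app f (renTs r ts)

    renTs : ∀ {Γ Δ σs} → Ren Γ Δ → Terms Γ σs → Terms Δ σs
    renTs r []       = []
    renTs r (t ∷ ts) = renT r t ∷ renTs r ts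

  Sub : Ctx → Ctx → Set
  Sub Γ Δ = ∀ {σ} → Γ ∋ σ → Term Δ σ

  liftS : ∀ {Γ Δ τ} → Sub Γ Δ → Sub (τ ∷ Γ) (τ ∷ Δ)
  liftS s here      = var here
  liftS s (there x) = renT there (s x)

  mutual
    subT : ∀ {Γ Δ σ} → Sub Γ Δ → Term Γ σ → Term Δ σ
    subT s (var x)    = s x
    subT s zeroᵗ      = zeroᵗ
    subT s (sucᵗ t)   = sucᵗ (subT s t)
    subT s (app f ts) = app f (subTs s ts)

    subTs : ∀ {Γ Δ σs} → Sub Γ Δ → Terms Γ σs → Terms Δ σs
    subTs s []       = []
    subTs s (t ∷ ts) = subT s t ∷ subTs s ts

  sucⁱ : ∀ {Γ} → ℕ → Term Γ nat → Term Γ nat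
  sucⁱ zero    t = t
  sucⁱ (suc i) t = sucᵗ (sucⁱ i t)

  num : ∀ {Γ} → ℕ → Term Γ nat
  num k = sucⁱ k zeroᵗ

  infixr 5 _⇒_
  infix 7 _≐_

  data Formula (Γ : Ctx) : Set where
    ⊥'  : Formula Γ
    _≐_ : ∀ {σ} → Term Γ σ → Term Γ σ → Formula Γ
    _⇒_ : Formula Γ → Formula Γ → Formula Γ
    ∀'  : (σ : Sort) → Formula (σ ∷ Γ) → Formula Γ

  ¬' : ∀ {Γ} → Formula Γ → Formula Γ
  ¬' φ = φ ⇒ ⊥'

  ⊤' : ∀ {Γ} → Formula Γ
  ⊤' = ¬' ⊥'

  _∨'_ : ∀ {Γ} → Formula Γ → Formula Γ → Formula Γ
  φ ∨' ψ = ¬' φ ⇒ ψ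

  _∧'_ : ∀ {Γ} → Formula Γ → Formula Γ → Formula Γ
  φ ∧' ψ = ¬' (φ ⇒ ¬' ψ)

  renF : ∀ {Γ Δ} → Ren Γ Δ → Formula Γ → Formula Δ
  renF r ⊥'       = ⊥'
  renF r (t ≐ u)  = renT r t ≐ renT r u
  renF r (φ ⇒ ψ)  = renF r φ ⇒ renF r ψ
  renF r (∀' σ φ) = ∀' σ (renF (liftR r) φ)

  subF : ∀ {Γ Δ} → Sub Γ Δ → Formula Γ → Formula Δ
  subF s ⊥'       = ⊥'
  subF s (t ≐ u)  = subT s t ≐ subT s u
  subF s (φ ⇒ ψ)  = subF s φ ⇒ subF s ψ
  subF s (∀' σ φ) = ∀' σ (subF (liftS s) φ)

  single : ∀ {Γ σ} → Term Γ σ → Sub (σ ∷ Γ) Γ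
  single t here      = t
  single t (there x) = var x

  _[_]₀ : ∀ {Γ σ} → Formula (σ ∷ Γ) → Term Γ σ → Formula Γ
  φ [ t ]₀ = subF (single t) φ

  wkF : ∀ {Γ σ} → Formula Γ → Formula (σ ∷ Γ)
  wkF = renF there

  fromEmpty : ∀ {Γ} → Ren [] Γ
  fromEmpty ()

  data QF {Γ : Ctx} : Formula Γ → Set where
    qf⊥ : QF ⊥'
    qf≐ : ∀ {σ} {t u : Term Γ σ} → QF (t ≐ u)
    qf⇒ : ∀ {φ ψ} → QF φ → QF ψ → QF (φ ⇒ ψ)

  Theory : Set₁
  Theory = Formula [] → Set

  infix 3 _⊢_

  data _⊢_ (T : Theory) : {Γ : Ctx} → Formula Γ → Set where
    ax     : ∀ {Γ φ} → T φ → T ⊢ renF {Γ = []} {Δ = Γ} fromEmpty φ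
    ax-K   : ∀ {Γ} {φ ψ : Formula Γ} → T ⊢ φ ⇒ ψ ⇒ φ
    ax-S   : ∀ {Γ} {φ ψ χ : Formula Γ} →
             T ⊢ (φ ⇒ ψ ⇒ χ) ⇒ (φ ⇒ ψ) ⇒ φ ⇒ χ
    ax-DN  : ∀ {Γ} {φ : Formula Γ} → T ⊢ ¬' (¬' φ) ⇒ φ
    mp     : ∀ {Γ} {φ ψ : Formula Γ} → T ⊢ φ ⇒ ψ → T ⊢ φ → T ⊢ ψ
    gen    : ∀ {Γ σ} {φ : Formula (σ ∷ Γ)} → T ⊢ φ → T ⊢ ∀' σ φ
    ax-∀E  : ∀ {Γ σ} {φ : Formula (σ ∷ Γ)} (t : Term Γ σ) →
             T ⊢ ∀' σ φ ⇒ φ [ t ]₀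
    ax-∀D  : ∀ {Γ σ} {φ : Formula Γ} {ψ : Formula (σ ∷ Γ)} →
             T ⊢ ∀' σ (wkF φ ⇒ ψ) ⇒ φ ⇒ ∀' σ ψ
    ax-ref : ∀ {Γ σ} (t : Term Γ σ) → T ⊢ t ≐ t
    ax-Lz  : ∀ {Γ σ} (φ : Formula (σ ∷ Γ)) (t u : Term Γ σ) →
             T ⊢ t ≐ u ⇒ φ [ t ]₀ ⇒ φ [ u ]₀

  ∅T : Theory
  ∅T _ = ⊥

  closeAll : (Zs : Ctx) → Formula Zs → Formula []
  closeAll []       φ = φ
  closeAll (σ ∷ Zs) φ = closeAll Zs (∀' σ φ)

  sucSub : ∀ {Γ} → Sub (nat ∷ Γ) (nat ∷ Γ)
  sucSub here      = sucᵗ (var here)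
  sucSub (there x) = var (there x)

  indAxiom : (Zs : Ctx) → Formula (nat ∷ Zs) → Formula []
  indAxiom Zs ψ =
    closeAll Zs (ψ [ zeroᵗ ]₀ ⇒ ∀' nat (ψ ⇒ subF sucSub ψ) ⇒ ∀' nat ψ)

  data OpenInduction : Theory where
    ind : (Zs : Ctx) (ψ : Formula (nat ∷ Zs)) → QF ψ →
          OpenInduction (indAxiom Zs ψ)

  ηCtx : Ctx
  ηCtx = nat ∷ []

  η : Term ηCtx nat
  η = var here

  record Literal (Xs : Ctx) : Set where
    field
      positive : Bool
      sort     : Sort
      notNat   : sort ≢ nat
      lhs rhs  : Term Xs sort

  -- ∀x⃗ (⋁_l η ≠ t_l(x⃗) ∨ C(x⃗))
  record NClause : Set where
    field
      vars      : Ctx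
      etaTerms  : List (Term vars nat)
      otherLits : List (Literal vars)

  NClauseSet : Set
  NClauseSet = List NClause

  closeOver : ∀ {Γ} (Xs : Ctx) → Formula (Xs ++ Γ) → Formula Γ
  closeOver []       φ = φ
  closeOver (σ ∷ Xs) φ = closeOver Xs (∀' σ φ)

  inlR : ∀ {Γ} (Xs : Ctx) → Ren Xs (Xs ++ Γ)
  inlR (τ ∷ Xs) here      = here
  inlR (τ ∷ Xs) (there x) = there (inlR Xs x)

  inrR : ∀ {Γ} (Xs : Ctx) → Ren Γ (Xs ++ Γ)
  inrR []       x = x
  inrR (τ ∷ Xs) x = there (inrR Xs x)

  disj : ∀ {Γ} → List (Formula Γ) → Formula Γ
  disj []       = ⊥'
  disj (φ ∷ φs) = φ ∨' disj φs

  conj : ∀ {Γ} → List (Formula Γ) → Formula Γ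
  conj []       = ⊤'
  conj (φ ∷ φs) = φ ∧' conj φs

  litF : ∀ {Xs} → Literal Xs → Formula (Xs ++ ηCtx)
  litF {Xs} l with Literal.positive l
  ... | true  = renT (inlR Xs) (Literal.lhs l) ≐ renT (inlR Xs) (Literal.rhs l)
  ... | false = ¬' (renT (inlR Xs) (Literal.lhs l) ≐ renT (inlR Xs) (Literal.rhs l))

  clauseF : NClause → Formula ηCtx
  clauseF C = closeOver vars (disj (map etaLit etaTerms) ∨' disj (map litF otherLits))
    where
      open NClause C
      etaLit : Term vars nat → Formula (vars ++ ηCtx)
      etaLit t = ¬' (renT (inrR vars) η ≐ renT (inlR vars) t)

  ⟦_⟧ : NClauseSet → Formula ηCtx
  ⟦ R ⟧ = conj (map clauseF R)

  _↓ᶜ_ : NClause → ℕ → NClause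
  C ↓ᶜ i = record C { etaTerms = map (sucⁱ i) (NClause.etaTerms C) }

  _↓_ : NClauseSet → ℕ → NClauseSet
  R ↓ i = map (_↓ᶜ i) R

  -- "A ⊢ B" for formulas with the free variable η (η held fixed)
  _⊩_ : Formula ηCtx → Formula ηCtx → Set
  A ⊩ B = ∅T ⊢ A ⇒ B

  η≠ : ℕ → Formula ηCtx
  η≠ k = ¬' (η ≐ num k)

  Cycle : NClauseSet → ℕ → ℕ → NClauseSet → Set
  Cycle R i j S =
    0 < j × S ⊆ R ×
    (∀ k → i ≤ k → k < i + j → ⟦ S ⟧ ⊩ η≠ k) ×
    ⟦ S ⟧ ⊩ ⟦ S ↓ j ⟧

  RefutedByCycle : NClauseSet → Set
  RefutedByCycle R =
    Σ ℕ λ i → Σ ℕ λ j → Σ NClauseSet λ S →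
      Cycle R i j S × (∀ k → k < i → ⟦ R ⟧ ⊩ η≠ k)

module Submission where

-- C₁ and C₃ give η ≠ 0, and C₁ with C₂ give C₁↓1, so (0, 1, S) is a
-- cycle.  Yet S holds in a model whose sort nat is ℕ followed by a copy of ℤ, with η the
-- zero of the copy, ι = ℕ, m u = u + 1, e = 0, a = true, and r(x, u) true iff x is
-- nonstandard or u < x.  Open induction holds there: a quantifier-free formula in x takes
-- the same truth value at all large standard x and all very negative nonstandard x, so
-- induction carries it through ℕ, across to the far left of the copy of ℤ, and from there
-- along the whole copy.

open import Defs
open import Data.Bool using (Bool; true; false)
open import Data.Bool.Properties using (T-≡)
open import Data.Empty using (⊥; ⊥-elim)
open import Data.List using (List; []; _∷_)
open import Data.List.Membership.Propositional using (_∈_)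
open import Data.List.Relation.Unary.All using (All; []; _∷_)
open import Data.List.Relation.Unary.Any using (here; there)
open import Data.Nat using (ℕ; zero; suc; _+_; _∸_; _⊔_; _<ᵇ_; _≤_; _<_; z≤n; s≤s)
open import Data.Nat.Properties
  using (≤-refl; ≤-trans; ≤-reflexive; <⇒≱; n<1+n; n≤1+n; m≤m+n; m≤n+m; m≤m⊔n; m≤n⊔m;
         +-cancelʳ-≡; ∸-cancelˡ-≡; +-∸-assoc; m+n∸m≡n; ∸-monoˡ-≤; <⇒<ᵇ; module ≤-Reasoning)
open import Data.Product using (Σ; ∃-syntax; _×_; _,_; proj₂)
open import Function using (id; _∘_)
open import Function.Bundles using (_⇔_; mk⇔; Equivalence)
import Function.Properties.Equivalence as ⇔
open import Function.Related.TypeIsomorphisms using (→-cong-⇔; ¬-cong-⇔)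
open import Relation.Binary.PropositionalEquality
open import Relation.Nullary using (¬_)
open import Relation.Nullary.Negation using (¬¬-map)

open Equivalence using (to; from)

≡-cong-⇔ : ∀ {A : Set} {a a′ b b′ : A} → a ≡ a′ → b ≡ b′ → (a ≡ b) ⇔ (a′ ≡ b′)
≡-cong-⇔ refl refl = ⇔.refl

¬¬≡-cong : ∀ {A : Set} {a a′ b b′ : A} → a ≡ a′ → b ≡ b′ → (¬ ¬ a ≡ b) ⇔ (¬ ¬ a′ ≡ b′)
¬¬≡-cong a≡a′ b≡b′ = ¬-cong-⇔ (¬-cong-⇔ (≡-cong-⇔ a≡a′ b≡b′))

∀-cong-⇔ : ∀ {A : Set} {P Q : A → Set} → (∀ a → P a ⇔ Q a) → (∀ a → P a) ⇔ (∀ a → Q a)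
∀-cong-⇔ P⇔Q = mk⇔ (λ p a → to (P⇔Q a) (p a)) (λ q a → from (P⇔Q a) (q a))

record Structure (L : Language) : Set₁ where
  open Language L
  field
    Carrier : Sort → Set
    zeroᴹ   : Carrier nat
    sucᴹ    : Carrier nat → Carrier nat
    funᴹ    : (f : Fun) → All Carrier (dom f) → Carrier (cod f)

module Satisfaction {L : Language} (M : Structure L) where
  open Language L
  open Syntax L
  open Structure M

  Env : Ctx → Set
  Env Γ = ∀ {σ} → Γ ∋ σ → Carrier σ

  []ᵉ : Env []
  []ᵉ ()

  infixr 5 _∷ᵉ_
  _∷ᵉ_ : ∀ {Γ σ} → Carrier σ → Env Γ → Env (σ ∷ Γ)
  (d ∷ᵉ ρ) here      = d
  (d ∷ᵉ ρ) (there x) = ρ x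

  mutual
    eval : ∀ {Γ σ} → Term Γ σ → Env Γ → Carrier σ
    eval (var x)    ρ = ρ x
    eval zeroᵗ      ρ = zeroᴹ
    eval (sucᵗ t)   ρ = sucᴹ (eval t ρ)
    eval (app f ts) ρ = funᴹ f (evals ts ρ)

    evals : ∀ {Γ σs} → Terms Γ σs → Env Γ → All Carrier σs
    evals []       ρ = []
    evals (t ∷ ts) ρ = eval t ρ ∷ evals ts ρ

  -- Equations are read double-negated, so that every formula is stable
  -- and the classical axiom ax-DN is sound without excluded middle.
  infix 4 _⊨_
  _⊨_ : ∀ {Γ} → Env Γ → Formula Γ → Set
  ρ ⊨ ⊥'       = ⊥
  ρ ⊨ t ≐ u    = ¬ ¬ (eval t ρ ≡ eval u ρ)
  ρ ⊨ φ ⇒ ψ    = ρ ⊨ φ → ρ ⊨ ψ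
  ρ ⊨ ∀' σ φ   = (d : Carrier σ) → d ∷ᵉ ρ ⊨ φ

  ⊨-stable : ∀ {Γ} (φ : Formula Γ) (ρ : Env Γ) → ¬ ¬ (ρ ⊨ φ) → ρ ⊨ φ
  ⊨-stable ⊥'       ρ ¬¬p = ¬¬p id
  ⊨-stable (t ≐ u)  ρ ¬¬p = λ t≢u → ¬¬p (λ p → p t≢u)
  ⊨-stable (φ ⇒ ψ)  ρ ¬¬p = λ p → ⊨-stable ψ ρ (¬¬-map (λ f → f p) ¬¬p)
  ⊨-stable (∀' σ φ) ρ ¬¬p = λ d → ⊨-stable φ (d ∷ᵉ ρ) (¬¬-map (λ f → f d) ¬¬p)

  mutual
    eval-renT : ∀ {Γ Δ σ} (r : Ren Γ Δ) {ρ : Env Δ} {ρ′ : Env Γ} →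
                (∀ {τ} (x : Γ ∋ τ) → ρ (r x) ≡ ρ′ x) →
                (t : Term Γ σ) → eval (renT r t) ρ ≡ eval t ρ′
    eval-renT r h (var x)    = h x
    eval-renT r h zeroᵗ      = refl
    eval-renT r h (sucᵗ t)   = cong sucᴹ (eval-renT r h t)
    eval-renT r h (app f ts) = cong (funᴹ f) (eval-renTs r h ts)

    eval-renTs : ∀ {Γ Δ σs} (r : Ren Γ Δ) {ρ : Env Δ} {ρ′ : Env Γ} →
                 (∀ {τ} (x : Γ ∋ τ) → ρ (r x) ≡ ρ′ x) →
                 (ts : Terms Γ σs) → evals (renTs r ts) ρ ≡ evals ts ρ′
    eval-renTs r h []       = refl
    eval-renTs r h (t ∷ ts) = cong₂ _∷_ (eval-renT r h t) (eval-renTs r h ts)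

  ⊨-renF : ∀ {Γ Δ} (r : Ren Γ Δ) {ρ : Env Δ} {ρ′ : Env Γ} →
           (∀ {τ} (x : Γ ∋ τ) → ρ (r x) ≡ ρ′ x) →
           (φ : Formula Γ) → (ρ ⊨ renF r φ) ⇔ (ρ′ ⊨ φ)
  ⊨-renF r h ⊥'       = ⇔.refl
  ⊨-renF r h (t ≐ u)  = ¬¬≡-cong (eval-renT r h t) (eval-renT r h u)
  ⊨-renF r h (φ ⇒ ψ)  = →-cong-⇔ (⊨-renF r h φ) (⊨-renF r h ψ)
  ⊨-renF r h (∀' σ φ) = ∀-cong-⇔ (λ d → ⊨-renF (liftR r) (lift-h d) φ)
    where
      lift-h : ∀ d {τ} (x : (σ ∷ _) ∋ τ) → (d ∷ᵉ _) (liftR r x) ≡ (d ∷ᵉ _) x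
      lift-h d here      = refl
      lift-h d (there x) = h x

  mutual
    eval-subT : ∀ {Γ Δ σ} (s : Sub Γ Δ) {ρ : Env Δ} {ρ′ : Env Γ} →
                (∀ {τ} (x : Γ ∋ τ) → eval (s x) ρ ≡ ρ′ x) →
                (t : Term Γ σ) → eval (subT s t) ρ ≡ eval t ρ′
    eval-subT s h (var x)    = h x
    eval-subT s h zeroᵗ      = refl
    eval-subT s h (sucᵗ t)   = cong sucᴹ (eval-subT s h t)
    eval-subT s h (app f ts) = cong (funᴹ f) (eval-subTs s h ts)

    eval-subTs : ∀ {Γ Δ σs} (s : Sub Γ Δ) {ρ : Env Δ} {ρ′ : Env Γ} →
                 (∀ {τ} (x : Γ ∋ τ) → eval (s x) ρ ≡ ρ′ x) →
                 (ts : Terms Γ σs) → evals (subTs s ts) ρ ≡ evals ts ρ′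
    eval-subTs s h []       = refl
    eval-subTs s h (t ∷ ts) = cong₂ _∷_ (eval-subT s h t) (eval-subTs s h ts)

  ⊨-subF : ∀ {Γ Δ} (s : Sub Γ Δ) {ρ : Env Δ} {ρ′ : Env Γ} →
           (∀ {τ} (x : Γ ∋ τ) → eval (s x) ρ ≡ ρ′ x) →
           (φ : Formula Γ) → (ρ ⊨ subF s φ) ⇔ (ρ′ ⊨ φ)
  ⊨-subF s h ⊥'       = ⇔.refl
  ⊨-subF s h (t ≐ u)  = ¬¬≡-cong (eval-subT s h t) (eval-subT s h u)
  ⊨-subF s h (φ ⇒ ψ)  = →-cong-⇔ (⊨-subF s h φ) (⊨-subF s h ψ)
  ⊨-subF s {ρ} h (∀' σ φ) = ∀-cong-⇔ (λ d → ⊨-subF (liftS s) (lift-h d) φ)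
    where
      lift-h : ∀ d {τ} (x : (σ ∷ _) ∋ τ) → eval (liftS s x) (d ∷ᵉ ρ) ≡ (d ∷ᵉ _) x
      lift-h d here      = refl
      lift-h d (there x) = trans (eval-renT there (λ _ → refl) (s x)) (h x)

  ⊨-[]₀ : ∀ {Γ σ} (φ : Formula (σ ∷ Γ)) (t : Term Γ σ) {ρ : Env Γ} →
          (ρ ⊨ φ [ t ]₀) ⇔ (eval t ρ ∷ᵉ ρ ⊨ φ)
  ⊨-[]₀ φ t = ⊨-subF (single t) (λ { here → refl ; (there x) → refl }) φ

  ⊨-wkF : ∀ {Γ σ} (φ : Formula Γ) {ρ : Env Γ} {d : Carrier σ} → (d ∷ᵉ ρ ⊨ wkF φ) ⇔ (ρ ⊨ φ)
  ⊨-wkF φ = ⊨-renF there (λ _ → refl) φ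

  IsModel : Theory → Set
  IsModel T = ∀ φ → T φ → []ᵉ ⊨ φ

  sound : ∀ {T} → IsModel T → ∀ {Γ} {φ : Formula Γ} → T ⊢ φ → (ρ : Env Γ) → ρ ⊨ φ
  sound M⊨T (ax {φ = φ} Tφ)    ρ = from (⊨-renF fromEmpty (λ ()) φ) (M⊨T φ Tφ)
  sound M⊨T ax-K               ρ = λ p _ → p
  sound M⊨T ax-S               ρ = λ f g p → f p (g p)
  sound M⊨T (ax-DN {φ = φ})    ρ = ⊨-stable φ ρ
  sound M⊨T (mp d e)           ρ = sound M⊨T d ρ (sound M⊨T e ρ)
  sound M⊨T (gen d)            ρ = λ x → sound M⊨T d (x ∷ᵉ ρ)
  sound M⊨T (ax-∀E {φ = φ} t)  ρ = λ ∀φ → from (⊨-[]₀ φ t) (∀φ (eval t ρ))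
  sound M⊨T (ax-∀D {φ = φ})    ρ = λ f p d → f d (from (⊨-wkF φ) p)
  sound M⊨T (ax-ref t)         ρ = λ t≢t → t≢t refl
  sound M⊨T (ax-Lz φ t u)      ρ = λ ¬¬t≡u φt → ⊨-stable (φ [ u ]₀) ρ
    (¬¬-map (λ t≡u → from (⊨-[]₀ φ u)
                       (subst (λ d → d ∷ᵉ ρ ⊨ φ) t≡u (to (⊨-[]₀ φ t) φt))) ¬¬t≡u)

  ⊨-closeAll : (Zs : Ctx) (φ : Formula Zs) → (∀ (ρ : Env Zs) → ρ ⊨ φ) → []ᵉ ⊨ closeAll Zs φ
  ⊨-closeAll []       φ ⊨φ = ⊨φ []ᵉ
  ⊨-closeAll (σ ∷ Zs) φ ⊨φ = ⊨-closeAll Zs (∀' σ φ) (λ ρ d → ⊨φ (d ∷ᵉ ρ))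

  InductionHolds : (Carrier nat → Set) → Set
  InductionHolds P = P zeroᴹ → (∀ x → P x → P (sucᴹ x)) → ∀ x → P x

  ⊨-indAxiom : (Zs : Ctx) (ψ : Formula (nat ∷ Zs)) →
               (∀ (ρ : Env Zs) → InductionHolds (λ x → x ∷ᵉ ρ ⊨ ψ)) → []ᵉ ⊨ indAxiom Zs ψ
  ⊨-indAxiom Zs ψ induction = ⊨-closeAll Zs _ λ ρ base step →
    induction ρ (to (⊨-[]₀ ψ zeroᵗ) base)
          (λ x p → to (⊨-subF sucSub (λ { here → refl ; (there _) → refl }) ψ) (step x p))

module NaturalDeduction {L : Language} (T : Syntax.Theory L) {Γ : Syntax.Ctx L} where
  open Syntax L

  infix 3 _⊢ₙ_
  infixl 5 _·_
  infixr 4 ƛ_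

  data _⊢ₙ_ (Hs : List (Formula Γ)) : Formula Γ → Set where
    hyp   : ∀ {φ} → φ ∈ Hs → Hs ⊢ₙ φ
    axiom : ∀ {φ} → T ⊢ φ → Hs ⊢ₙ φ
    _·_   : ∀ {φ ψ} → Hs ⊢ₙ φ ⇒ ψ → Hs ⊢ₙ φ → Hs ⊢ₙ ψ

  ⊢-id : ∀ {φ : Formula Γ} → T ⊢ φ ⇒ φ
  ⊢-id {φ} = mp (mp (ax-S {φ = φ} {ψ = φ ⇒ φ} {χ = φ}) ax-K) (ax-K {ψ = φ})

  ƛ_ : ∀ {Hs φ ψ} → φ ∷ Hs ⊢ₙ ψ → Hs ⊢ₙ φ ⇒ ψ
  ƛ hyp (here refl) = axiom ⊢-id
  ƛ hyp (there φ∈Hs) = axiom ax-K · hyp φ∈Hs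
  ƛ axiom d         = axiom ax-K · axiom d
  ƛ (f · p)         = axiom ax-S · (ƛ f) · (ƛ p)

  weaken : ∀ {Hs φ ψ} → Hs ⊢ₙ φ → ψ ∷ Hs ⊢ₙ φ
  weaken (hyp φ∈Hs) = hyp (there φ∈Hs)
  weaken (axiom d)  = axiom d
  weaken (f · p)    = weaken f · weaken p

  closed : ∀ {φ} → [] ⊢ₙ φ → T ⊢ φ
  closed (axiom d) = d
  closed (f · p)   = mp (closed f) (closed p)

  #0 : ∀ {Hs φ} → φ ∷ Hs ⊢ₙ φ
  #0 = hyp (here refl)

  #1 : ∀ {Hs φ ψ} → ψ ∷ φ ∷ Hs ⊢ₙ φ
  #1 = hyp (there (here refl))

  #2 : ∀ {Hs φ ψ χ} → χ ∷ ψ ∷ φ ∷ Hs ⊢ₙ φ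
  #2 = hyp (there (there (here refl)))

  by-contradiction : ∀ {Hs φ} → ¬' φ ∷ Hs ⊢ₙ ⊥' → Hs ⊢ₙ φ
  by-contradiction p = axiom ax-DN · (ƛ p)

  ⊤-intro : ∀ {Hs} → Hs ⊢ₙ ⊤'
  ⊤-intro = ƛ #0

  ∧-intro : ∀ {Hs φ ψ} → Hs ⊢ₙ φ → Hs ⊢ₙ ψ → Hs ⊢ₙ φ ∧' ψ
  ∧-intro p q = ƛ (#0 · weaken p · weaken q)

  ∧-elimˡ : ∀ {Hs φ ψ} → Hs ⊢ₙ φ ∧' ψ → Hs ⊢ₙ φ
  ∧-elimˡ p = by-contradiction (weaken p · (ƛ ƛ (#2 · #1)))

  ∧-elimʳ : ∀ {Hs φ ψ} → Hs ⊢ₙ φ ∧' ψ → Hs ⊢ₙ ψ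
  ∧-elimʳ p = by-contradiction (weaken p · (ƛ #1))

  ∀-elim : ∀ {Hs σ} {φ : Formula (σ ∷ Γ)} (t : Term Γ σ) → Hs ⊢ₙ ∀' σ φ → Hs ⊢ₙ φ [ t ]₀
  ∀-elim t p = axiom (ax-∀E t) · p

  ⇒∀-intro : ∀ {σ} {φ : Formula Γ} {ψ : Formula (σ ∷ Γ)} → T ⊢ wkF φ ⇒ ψ → T ⊢ φ ⇒ ∀' σ ψ
  ⇒∀-intro d = mp ax-∀D (gen d)

-- pos n is n and neg k is −(k+1) in the copy of ℤ that follows ℕ.
data ℕ⊕ℤ : Set where
  std pos neg : ℕ → ℕ⊕ℤ

suc* : ℕ⊕ℤ → ℕ⊕ℤ
suc* (std n)       = std (suc n)
suc* (pos n)       = pos (suc n)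
suc* (neg zero)    = pos zero
suc* (neg (suc k)) = neg k

infixr 6 _+*_
_+*_ : ℕ → ℕ⊕ℤ → ℕ⊕ℤ
zero  +* x = x
suc a +* x = suc* (a +* x)

size : ℕ⊕ℤ → ℕ
size (std n) = n
size (pos n) = n
size (neg k) = k

+*-std : ∀ a n → a +* std n ≡ std (a + n)
+*-std zero    n = refl
+*-std (suc a) n = cong suc* (+*-std a n)

+*-neg : ∀ {a k} → a ≤ k → a +* neg k ≡ neg (k ∸ a)
+*-neg {zero}  _             = refl
+*-neg {suc a} (s≤s {n = k} a≤k) = begin
  suc* (a +* neg (suc k))  ≡⟨ cong suc* (+*-neg (≤-trans a≤k (n≤1+n k))) ⟩
  suc* (neg (suc k ∸ a))   ≡⟨ cong (suc* ∘ neg) (+-∸-assoc 1 a≤k) ⟩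
  neg (k ∸ a)              ∎
  where open ≡-Reasoning

+*-neg-zero : ∀ n → suc n +* neg zero ≡ pos n
+*-neg-zero zero    = refl
+*-neg-zero (suc n) = cong suc* (+*-neg-zero n)

+*-cancel-std : ∀ a b n → a +* std n ≡ b +* std n → a ≡ b
+*-cancel-std a b n eq = +-cancelʳ-≡ n a b (cong size
  (trans (sym (+*-std a n)) (trans eq (+*-std b n))))

+*-cancel-neg : ∀ {a b k} → a ≤ k → b ≤ k → a +* neg k ≡ b +* neg k → a ≡ b
+*-cancel-neg a≤k b≤k eq = ∸-cancelˡ-≡ a≤k b≤k (cong size
  (trans (sym (+*-neg a≤k)) (trans eq (+*-neg b≤k))))

+*-std-far : ∀ a c {n} → suc (size c) ≤ n → a +* std n ≢ c
+*-std-far a (std j) {n} j<n eq = <⇒≱ j<n (begin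
  n      ≤⟨ m≤n+m n a ⟩
  a + n  ≡⟨ cong size (trans (sym (+*-std a n)) eq) ⟩
  j      ∎)
  where open ≤-Reasoning
+*-std-far a (pos j) {n} _ eq with () ← trans (sym (+*-std a n)) eq
+*-std-far a (neg j) {n} _ eq with () ← trans (sym (+*-std a n)) eq

+*-neg-far : ∀ a c {k} → a + suc (size c) ≤ k → a +* neg k ≢ c
+*-neg-far a c {k} far eq with +*-neg {a} {k} (≤-trans (m≤m+n a _) far)
+*-neg-far a (neg j) {k} far eq | a+*k = <⇒≱ (begin-strict
  j                   <⟨ n<1+n j ⟩
  suc j               ≡⟨ m+n∸m≡n a (suc j) ⟨
  a + suc j ∸ a       ≤⟨ ∸-monoˡ-≤ a far ⟩
  k ∸ a               ∎) (≤-reflexive (cong size (trans (sym a+*k) eq)))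
  where open ≤-Reasoning
+*-neg-far a (std j) far eq | a+*k with () ← trans (sym a+*k) eq
+*-neg-far a (pos j) far eq | a+*k with () ← trans (sym a+*k) eq

record EndsAgree (P : ℕ⊕ℤ → Set) (B : ℕ) : Set where
  constructor mkEndsAgree
  field ends⇔ : ∀ {n k} → B ≤ n → B ≤ k → P (std n) ⇔ P (neg k)
open EndsAgree

EndsMatch : {A : Set} → (ℕ⊕ℤ → A) → ℕ → Set
EndsMatch f B = ∀ {n k} → B ≤ n → B ≤ k → f (std n) ≡ f (neg k)

EndsAgree-mono : ∀ {P B B′} → B ≤ B′ → EndsAgree P B → EndsAgree P B′
EndsAgree-mono B≤B′ agree = mkEndsAgree λ n≥B′ k≥B′ →
  ends⇔ agree (≤-trans B≤B′ n≥B′) (≤-trans B≤B′ k≥B′)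

EndsAgree-resp : ∀ {P Q B} → (∀ x → P x ⇔ Q x) → EndsAgree P B → EndsAgree Q B
EndsAgree-resp P⇔Q agree = mkEndsAgree λ {n} {k} n≥B k≥B →
  ⇔.trans (⇔.sym (P⇔Q (std n))) (⇔.trans (ends⇔ agree n≥B k≥B) (P⇔Q (neg k)))

EndsAgree-const : (A : Set) → EndsAgree (λ _ → A) 0
EndsAgree-const A = mkEndsAgree λ _ _ → ⇔.refl

EndsAgree-→ : ∀ {P Q B C} → EndsAgree P B → EndsAgree Q C → EndsAgree (λ x → P x → Q x) (B ⊔ C)
EndsAgree-→ {B = B} {C} agreeP agreeQ = mkEndsAgree λ n≥ k≥ → →-cong-⇔
  (ends⇔ (EndsAgree-mono (m≤m⊔n B C) agreeP) n≥ k≥)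
  (ends⇔ (EndsAgree-mono (m≤n⊔m B C) agreeQ) n≥ k≥)

EndsAgree-¬¬ : ∀ {P B} → EndsAgree P B → EndsAgree (λ x → ¬ ¬ P x) B
EndsAgree-¬¬ agree = mkEndsAgree λ n≥B k≥B → ¬-cong-⇔ (¬-cong-⇔ (ends⇔ agree n≥B k≥B))

EndsAgree-≡ : ∀ {A : Set} (f g : ℕ⊕ℤ → A) {B C} →
              EndsMatch f B → EndsMatch g C → EndsAgree (λ x → f x ≡ g x) (B ⊔ C)
EndsAgree-≡ f g {B} {C} f-match g-match = mkEndsAgree λ n≥ k≥ → ≡-cong-⇔
  (f-match (≤-trans (m≤m⊔n B C) n≥) (≤-trans (m≤m⊔n B C) k≥))
  (g-match (≤-trans (m≤n⊔m B C) n≥) (≤-trans (m≤n⊔m B C) k≥))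

EndsAgree-offsets : ∀ a b → EndsAgree (λ x → a +* x ≡ b +* x) (a ⊔ b)
EndsAgree-offsets a b = mkEndsAgree λ {n} _ k≥ → mk⇔
  (λ eq → cong (_+* neg _) (+*-cancel-std a b n eq))
  (λ eq → cong (_+* std n)
     (+*-cancel-neg (≤-trans (m≤m⊔n a b) k≥) (≤-trans (m≤n⊔m a b) k≥) eq))

EndsAgree-offset-const : ∀ a c → EndsAgree (λ x → a +* x ≡ c) (a + suc (size c))
EndsAgree-offset-const a c = mkEndsAgree λ n≥ k≥ → mk⇔
  (λ eq → ⊥-elim (+*-std-far a c (≤-trans (m≤n+m _ a) n≥) eq))
  (λ eq → ⊥-elim (+*-neg-far a c k≥ eq))

induction-by-agreement : ∀ {P B} → EndsAgree P B →
  P (std zero) → (∀ x → P x → P (suc* x)) → ∀ x → P x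
induction-by-agreement {P} {B} agree base step = P-all
  where
    step* : ∀ a {x} → P x → P (a +* x)
    step* zero    p = p
    step* (suc a) {x} p = step (a +* x) (step* a p)

    P-std : ∀ n → P (std n)
    P-std zero    = base
    P-std (suc n) = step (std n) (P-std n)

    P-neg : ∀ k → P (neg k)
    P-neg k = subst P (trans (+*-neg (m≤m+n B k)) (cong neg (m+n∸m≡n B k)))
      (step* B (to (ends⇔ agree ≤-refl (m≤m+n B k)) (P-std B)))

    P-all : ∀ x → P x
    P-all (std n) = P-std n
    P-all (pos n) = subst P (+*-neg-zero n) (step* (suc n) (P-neg zero))
    P-all (neg k) = P-neg k

module Counterexample where
  data Sortℒ : Set where
    nat ι bool : Sortℒ

  data Funℒ : Set where
    rᶠ mᶠ eᶠ aᶠ : Funℒ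

  domℒ : Funℒ → List Sortℒ
  domℒ rᶠ = nat ∷ ι ∷ []
  domℒ mᶠ = ι ∷ []
  domℒ eᶠ = []
  domℒ aᶠ = []

  codℒ : Funℒ → Sortℒ
  codℒ rᶠ = bool
  codℒ mᶠ = ι
  codℒ eᶠ = ι
  codℒ aᶠ = bool

  ℒ : Language
  ℒ = record { Sort = Sortℒ ; nat = nat ; Fun = Funℒ ; dom = domℒ ; cod = codℒ }

  ℒ-isNLanguage : NLanguage ℒ
  ℒ-isNLanguage = (bool , λ ()) , λ { rᶠ () ; mᶠ () ; eᶠ () ; aᶠ () }

  Carrier𝕄 : Sortℒ → Set
  Carrier𝕄 nat  = ℕ⊕ℤ
  Carrier𝕄 ι    = ℕ
  Carrier𝕄 bool = Bool

  below : ℕ⊕ℤ → ℕ → Bool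
  below (std n) u = u <ᵇ n
  below (pos _) _ = true
  below (neg _) _ = true

  fun𝕄 : (f : Funℒ) → All Carrier𝕄 (domℒ f) → Carrier𝕄 (codℒ f)
  fun𝕄 rᶠ (x ∷ u ∷ []) = below x u
  fun𝕄 mᶠ (u ∷ [])     = suc u
  fun𝕄 eᶠ []           = zero
  fun𝕄 aᶠ []           = true

  𝕄 : Structure ℒ
  𝕄 = record { Carrier = Carrier𝕄 ; zeroᴹ = std zero ; sucᴹ = suc* ; funᴹ = fun𝕄 }

  open Syntax ℒ
  open Satisfaction 𝕄

  module QuantifierFreeAgreement {Zs : Ctx} (ρ : Env Zs) where

    _⟨_⟩ : ∀ {τ} → Term (nat ∷ Zs) τ → ℕ⊕ℤ → Carrier𝕄 τ
    t ⟨ x ⟩ = eval t (x ∷ᵉ ρ)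

    data NatShape (t : Term (nat ∷ Zs) nat) : Set where
      offset   : ∀ a → (∀ x → t ⟨ x ⟩ ≡ a +* x) → NatShape t
      constant : ∀ c → (∀ x → t ⟨ x ⟩ ≡ c) → NatShape t

    Behaviour : ∀ τ → Term (nat ∷ Zs) τ → Set
    Behaviour nat  t = NatShape t
    Behaviour ι    t = ∀ x y → t ⟨ x ⟩ ≡ t ⟨ y ⟩
    Behaviour bool t = ∃[ B ] EndsMatch (t ⟨_⟩) B

    constant-behaviour : ∀ τ (t : Term (nat ∷ Zs) τ) →
                         (∀ x y → t ⟨ x ⟩ ≡ t ⟨ y ⟩) → Behaviour τ t
    constant-behaviour nat  t t-const = constant (t ⟨ std zero ⟩) (λ x → t-const x (std zero))
    constant-behaviour ι    t t-const = t-const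
    constant-behaviour bool t t-const = zero , λ _ _ → t-const _ _

    -- Once x exceeds the (x-independent) value of u, both ends make r(a + x, u) true.
    below-behaviour : ∀ (t : Term (nat ∷ Zs) nat) (u : Term (nat ∷ Zs) ι) →
                      NatShape t → Behaviour ι u →
                      ∃[ B ] EndsMatch (λ x → below (t ⟨ x ⟩) (u ⟨ x ⟩)) B
    below-behaviour t u (constant c t≡c) u-const =
      zero , λ _ _ → cong₂ below (trans (t≡c _) (sym (t≡c _))) (u-const _ _)
    below-behaviour t u (offset a t≡a+x) u-const =
      a + suc U , λ n≥ k≥ → trans (at-std n≥) (sym (at-neg k≥))
      where
        U : ℕ
        U = u ⟨ std zero ⟩

        at-std : ∀ {n} → a + suc U ≤ n → below (t ⟨ std n ⟩) (u ⟨ std n ⟩) ≡ true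
        at-std {n} n≥ rewrite t≡a+x (std n) | +*-std a n | u-const (std n) (std zero) =
          to T-≡ (<⇒<ᵇ (≤-trans (m≤n+m (suc U) a) (≤-trans n≥ (m≤n+m n a))))

        at-neg : ∀ {k} → a + suc U ≤ k → below (t ⟨ neg k ⟩) (u ⟨ neg k ⟩) ≡ true
        at-neg {k} k≥ rewrite t≡a+x (neg k) | +*-neg (≤-trans (m≤m+n a (suc U)) k≥) = refl

    behaviour : ∀ {τ} (t : Term (nat ∷ Zs) τ) → Behaviour τ t
    behaviour (var here)              = offset zero (λ _ → refl)
    behaviour {τ} (var (there v))     = constant-behaviour τ (var (there v)) (λ _ _ → refl)
    behaviour zeroᵗ                   = constant (std zero) (λ _ → refl)
    behaviour (sucᵗ t) with behaviour t
    ... | offset a t≡   = offset (suc a) (cong suc* ∘ t≡)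
    ... | constant c t≡ = constant (suc* c) (cong suc* ∘ t≡)
    behaviour (app rᶠ (t ∷ u ∷ []))   = below-behaviour t u (behaviour t) (behaviour u)
    behaviour (app mᶠ (u ∷ []))       = λ x y → cong suc (behaviour u x y)
    behaviour (app eᶠ [])             = λ _ _ → refl
    behaviour (app aᶠ [])             = zero , λ _ _ → refl

    nat-atom : ∀ {t u : Term (nat ∷ Zs) nat} → NatShape t → NatShape u →
               ∃[ B ] EndsAgree (λ x → t ⟨ x ⟩ ≡ u ⟨ x ⟩) B
    nat-atom (offset a t≡) (offset b u≡) =
      a ⊔ b , EndsAgree-resp (λ x → ≡-cong-⇔ (sym (t≡ x)) (sym (u≡ x))) (EndsAgree-offsets a b)
    nat-atom (offset a t≡) (constant c u≡) =
      a + suc (size c) , EndsAgree-resp (λ x → ≡-cong-⇔ (sym (t≡ x)) (sym (u≡ x)))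
                                        (EndsAgree-offset-const a c)
    nat-atom {t} {u} (constant c t≡) (offset a u≡) =
      a + suc (size c) , EndsAgree-resp (λ x → mk⇔ sym sym)
                                        (proj₂ (nat-atom {u} {t} (offset a u≡) (constant c t≡)))
    nat-atom {t} {u} (constant c t≡) (constant d u≡) =
      zero , EndsAgree-≡ (t ⟨_⟩) (u ⟨_⟩) {zero} {zero} (λ _ _ → trans (t≡ _) (sym (t≡ _)))
                                                             (λ _ _ → trans (u≡ _) (sym (u≡ _)))

    atom : ∀ {τ} (t u : Term (nat ∷ Zs) τ) → ∃[ B ] EndsAgree (λ x → t ⟨ x ⟩ ≡ u ⟨ x ⟩) B
    atom {nat}  t u = nat-atom (behaviour t) (behaviour u)
    atom {ι}    t u = zero , EndsAgree-≡ (t ⟨_⟩) (u ⟨_⟩) {zero} {zero}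
                               (λ _ _ → behaviour t _ _) (λ _ _ → behaviour u _ _)
    atom {bool} t u with behaviour t | behaviour u
    ... | B , t-match | C , u-match = B ⊔ C , EndsAgree-≡ (t ⟨_⟩) (u ⟨_⟩) t-match u-match

    qf-agree : (ψ : Formula (nat ∷ Zs)) → QF ψ → ∃[ B ] EndsAgree (λ x → x ∷ᵉ ρ ⊨ ψ) B
    qf-agree ⊥'              qf⊥ = zero , EndsAgree-const ⊥
    qf-agree (t ≐ u)         qf≐ = let B , agree = atom t u in B , EndsAgree-¬¬ agree
    qf-agree (φ ⇒ ψ) (qf⇒ qφ qψ) with qf-agree φ qφ | qf-agree ψ qψ
    ... | B , agreeφ | C , agreeψ = B ⊔ C , EndsAgree-→ agreeφ agreeψ

  𝕄⊨OpenInduction : IsModel OpenInduction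
  𝕄⊨OpenInduction _ (ind Zs ψ qf) = ⊨-indAxiom Zs ψ λ ρ →
    induction-by-agreement (proj₂ (QuantifierFreeAgreement.qf-agree ρ ψ qf))

  r⟨_,_⟩ : ∀ {Γ} → Term Γ nat → Term Γ ι → Term Γ bool
  r⟨ t , u ⟩ = app rᶠ (t ∷ u ∷ [])

  m⟨_⟩ : ∀ {Γ} → Term Γ ι → Term Γ ι
  m⟨ u ⟩ = app mᶠ (u ∷ [])

  eᵗ : ∀ {Γ} → Term Γ ι
  eᵗ = app eᶠ []

  aᵗ : ∀ {Γ} → Term Γ bool
  aᵗ = app aᶠ []

  infix 6 _≐ᴸ_ _≠ᴸ_
  _≐ᴸ_ _≠ᴸ_ : ∀ {Xs} → Term Xs bool → Term Xs bool → Literal Xs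
  t ≐ᴸ u = record { positive = true  ; sort = bool ; notNat = λ () ; lhs = t ; rhs = u }
  t ≠ᴸ u = record { positive = false ; sort = bool ; notNat = λ () ; lhs = t ; rhs = u }

  x : ∀ {Γ} → Term (nat ∷ ι ∷ Γ) nat
  x = var here

  u : ∀ {Γ} → Term (nat ∷ ι ∷ Γ) ι
  u = var (there here)

  C₁ : NClause
  C₁ = record { vars = nat ∷ ι ∷ [] ; etaTerms = x ∷ [] ; otherLits = r⟨ x , u ⟩ ≐ᴸ aᵗ ∷ [] }

  C₂ : NClause
  C₂ = record { vars = nat ∷ ι ∷ [] ; etaTerms = []
              ; otherLits = r⟨ sucᵗ x , m⟨ u ⟩ ⟩ ≠ᴸ aᵗ ∷ r⟨ x , u ⟩ ≐ᴸ aᵗ ∷ [] }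

  C₃ : NClause
  C₃ = record { vars = [] ; etaTerms = [] ; otherLits = r⟨ zeroᵗ , eᵗ ⟩ ≠ᴸ aᵗ ∷ [] }

  S : NClauseSet
  S = C₁ ∷ C₂ ∷ C₃ ∷ []

  open NaturalDeduction ∅T

  -- C₁ at (u, x) := (e, 0) gives η ≠ 0 ∨ r(0, e) = a; C₃ refutes the second disjunct.
  S⊩η≠0 : ⟦ S ⟧ ⊩ η≠ 0
  S⊩η≠0 = closed (ƛ ƛ (∧-elimˡ (∧-elimʳ (∧-elimʳ #1)) · ⊤-intro
                       · (∀-elim zeroᵗ (∀-elim eᵗ (∧-elimˡ #1)) · (ƛ #0 · (ƛ #0 · #2)))))

  -- C₁ at (m u, s x) gives η ≠ s x ∨ r(s x, m u) = a, and C₂ turns r(s x, m u) = a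
  -- into the disjunct r(x, u) = a of C₁↓1.
  S⊩C₁↓1 : ⟦ S ⟧ ⊩ clauseF (C₁ ↓ᶜ 1)
  S⊩C₁↓1 = ⇒∀-intro (⇒∀-intro (closed (ƛ ƛ ƛ
    (∀-elim x (∀-elim u (∧-elimˡ (∧-elimʳ #2))) · ⊤-intro
      · (∀-elim (sucᵗ x) (∀-elim m⟨ u ⟩ (∧-elimˡ #2)) · #1) · #0))))

  S⊩S↓1 : ⟦ S ⟧ ⊩ ⟦ S ↓ 1 ⟧
  S⊩S↓1 = closed (ƛ ∧-intro (axiom S⊩C₁↓1 · #0)
                   (∧-intro (∧-elimˡ (∧-elimʳ #0)) (∧-intro (∧-elimˡ (∧-elimʳ (∧-elimʳ #0))) ⊤-intro)))

  S-refutedByCycle : RefutedByCycle S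
  S-refutedByCycle = 0 , 1 , S , (s≤s z≤n , id , S⊩η≠k , S⊩S↓1) , λ _ ()
    where
      S⊩η≠k : ∀ k → 0 ≤ k → k < 0 + 1 → ⟦ S ⟧ ⊩ η≠ k
      S⊩η≠k zero    _ _         = S⊩η≠0
      S⊩η≠k (suc k) _ (s≤s ())

  ηᴹ : Env ηCtx
  ηᴹ here = pos zero

  ηᴹ⊨S : ηᴹ ⊨ ⟦ S ⟧
  ηᴹ⊨S = λ f → f ⊨C₁ (λ g → g ⊨C₂ (λ h → h ⊨C₃ id))
    where
      ⊨C₁ : ηᴹ ⊨ clauseF C₁
      ⊨C₁ _ (std n) ¬η≠x _   = ⊥-elim (¬η≠x (λ ¬η≠x′ → ¬η≠x′ (λ η≡x → η≡x (λ ()))))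
      ⊨C₁ _ (pos n) _ ¬r≡a   = ¬r≡a (λ r≢a → r≢a refl)
      ⊨C₁ _ (neg k) _ ¬r≡a   = ¬r≡a (λ r≢a → r≢a refl)

      ⊨C₂ : ηᴹ ⊨ clauseF C₂
      -- For standard x = n, r(s x, m u) and r(x, u) are both the boolean u <ᵇ n.
      ⊨C₂ _ (std n)       _ r[sx,mu]≡a = r[sx,mu]≡a
      ⊨C₂ _ (pos n)       _ _ ¬r≡a     = ¬r≡a (λ r≢a → r≢a refl)
      ⊨C₂ _ (neg zero)    _ _ ¬r≡a     = ¬r≡a (λ r≢a → r≢a refl)
      ⊨C₂ _ (neg (suc k)) _ _ ¬r≡a     = ¬r≡a (λ r≢a → r≢a refl)

      ⊨C₃ : ηᴹ ⊨ clauseF C₃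
      ⊨C₃ _ ¬r≢a = ¬r≢a (λ r≡a → r≡a (λ ()))

  S-unprovable : ¬ (OpenInduction ⊢ ¬' ⟦ S ⟧)
  S-unprovable ⊢¬S = sound 𝕄⊨OpenInduction ⊢¬S ηᴹ ηᴹ⊨S

open Syntax

corollary5p8 : Σ Language λ L → NLanguage L × Σ (NClauseSet L) λ S →
    RefutedByCycle L S × ¬ (_⊢_ L (OpenInduction L) (¬' L (⟦_⟧ L S)))
corollary5p8 = ℒ , ℒ-isNLanguage , S , S-refutedByCycle , S-unprovable
  where open Counterexample
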